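{- Let $G$ be a finite graph on vertex set $V$. The sink sequence map $f$ is a bijection from the set of acyclic orientations of $G$ to the set of stable link sequences of $G$.
   Context: A subset $S\subseteq V$ is stable if no edge of $G$ has both ends in $S$. A stable link sequence of $G$ is an ordered set partition $\sigma=(\sigma_1,\ldots,\sigma_r)$ of $V$ (nonempty blocks) such that each $\sigma_i$ is stable and, for each $v\in V\setminus\sigma_1$, there is an edge of $G$ between $v$ and some element of the block immediately preceding the block containing $v$. For an acyclic orientation $A$ of $G$, its sink sequence $f(A)$ is the ordered set partition defined by: $\sigma_1$ is the set of sinks of $A$, and $\sigma_{k+1}$ is the set of sinks of the restriction of $A$ to $V\setminus(\sigma_1\cup\cdots\cup\sigma_k)$, continued until all vertices are used. -}

module Defs where

open import Data.Nat using (ℕ; zero; suc; _<_)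
open import Data.Bool using (Bool; true; false; _∧_; not)
open import Data.Fin using (Fin)
open import Data.List using (List; allFin; foldr; map)
open import Data.Product using (Σ; _×_; ∃; ∃-syntax)
open import Relation.Binary.PropositionalEquality using (_≡_; _≢_)
open import Relation.Nullary using (¬_)

record Graph (n : ℕ) : Set where
  field
    adj     : Fin n → Fin n → Bool
    sym     : ∀ u v → adj u v ≡ adj v u
    irrefl  : ∀ v → adj v v ≡ false
open Graph public

Vertex : ∀ {n} → Graph n → Set
Vertex {n} _ = Fin n

-- An orientation of G: a Boolean "arc" relation O (O u v = true means the
-- edge uv is directed u → v) such that arcs are only on edges and every
-- edge receives exactly one direction.
record IsOrientation {n : ℕ} (G : Graph n) (O : Fin n → Fin n → Bool) : Set where
  field
    arc⇒edge  : ∀ u v → O u v ≡ true → adj G u v ≡ true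
    edge⇒one  : ∀ u v → adj G u v ≡ true → O u v ≡ not (O v u)

data Walk⁺ {n : ℕ} (O : Fin n → Fin n → Bool) : Fin n → Fin n → Set where
  arc  : ∀ {u v} → O u v ≡ true → Walk⁺ O u v
  _∷_  : ∀ {u v w} → O u v ≡ true → Walk⁺ O v w → Walk⁺ O u w

Acyclic : ∀ {n} → (Fin n → Fin n → Bool) → Set
Acyclic {n} O = ∀ (v : Fin n) → ¬ Walk⁺ O v v

record AcyclicOrientation {n : ℕ} (G : Graph n) : Set where
  field
    arcs        : Fin n → Fin n → Bool
    orientation : IsOrientation G arcs
    acyclic     : Acyclic arcs
open AcyclicOrientation public

-- Ordered set partitions of V = Fin n are encoded by their block-index
-- function  b : Fin n → ℕ  (v lies in block σ_{b v + 1}, blocks are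
-- numbered from 0).

IsOrderedSetPartition : ∀ {n} → (Fin n → ℕ) → Set
IsOrderedSetPartition {n} b =
  Σ ℕ λ r → (∀ v → b v < r) × (∀ i → i < r → ∃[ v ] b v ≡ i)

IsStableLinkSequence : ∀ {n} → Graph n → (Fin n → ℕ) → Set
IsStableLinkSequence {n} G b =
  IsOrderedSetPartition b ×
  (∀ u v → adj G u v ≡ true → b u ≢ b v) ×
  (∀ v → b v ≢ 0 → ∃[ u ] (adj G u v ≡ true × suc (b u) ≡ b v))

isSinkIn : ∀ {n} → (Fin n → Fin n → Bool) → (Fin n → Bool) → Fin n → Bool
isSinkIn {n} O R v = R v ∧ foldr _∧_ true (map (λ w → not (R w ∧ O v w)) (allFin n))

remaining : ∀ {n} → (Fin n → Fin n → Bool) → ℕ → Fin n → Bool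
remaining O zero    v = true
remaining O (suc k) v = remaining O k v ∧ not (isSinkIn O (remaining O k) v)

-- Block index of v: least k < fuel with v a sink of O|R_k
-- (default: fuel, which never occurs for acyclic O with fuel = n).
blockFrom : ∀ {n} → (Fin n → Fin n → Bool) → ℕ → ℕ → Fin n → ℕ
blockFrom O k zero       v = k
blockFrom O k (suc fuel) v with isSinkIn O (remaining O k) v
... | true  = k
... | false = blockFrom O (suc k) fuel v

sinkSeq : ∀ {n} {G : Graph n} → AcyclicOrientation G → Fin n → ℕ
sinkSeq {n} A = blockFrom (arcs A) 0 n

-- Write R_k for the vertices remaining after k rounds of
-- sink removal, so that v lies in block j of f(A) exactly when v "leaves
-- at j": v ∈ R_j but v ∉ R_{j+1}.
--  * A vertex surviving k rounds starts a directed chain of k arcs (a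
--    non-sink always has an out-neighbour among the remaining vertices).
--    By pigeonhole a chain of n arcs repeats a vertex, so for acyclic A
--    every vertex leaves at some j < n, and that j is its block index.
--  * Arcs strictly decrease the block index, and a vertex of block j+1 has an arc into
--    block j.  Hence f(A) is a stable link sequence, and every arc points
--    from the larger to the smaller block index, so A is recovered from
--    f(A): the map is injective.
--  * Conversely, orienting every edge of a stable link sequence b towards
--    the smaller block gives an acyclic orientation in which R_k is
--    exactly {v | k ≤ b v}; hence its sink sequence is b: the map is onto.
module Submission where

open import Defs renaming (sym to adj-sym)
open import Data.Nat using (ℕ; zero; suc; _<_; _≤_; _+_; z≤n; s≤s; _<ᵇ_; _≤′_; ≤′-refl; ≤′-step)
open import Data.Nat.Properties
  using ( <-cmp; <-irrefl; <-trans; ≤-refl; ≤-reflexive; ≤-antisym; ≤-pred; <⇒≤; ≤⇒≤′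
        ; <⇒≯; <⇒≱; ≰⇒>; ≮⇒≥; ≤∧≢⇒<; 1+n≰n; n<1+n; m<n⇒n≢0; m≤n⇒m<n∨m≡n
        ; 0≢1+n; suc-injective; +-identityʳ; +-suc; <⇒<ᵇ; <ᵇ⇒< )
open import Data.Bool using (Bool; true; false; _∧_; not)
open import Data.Bool.Properties using (∧-zeroʳ; ∧-conicalˡ; ∧-conicalʳ; not-injective; not-¬; ¬-not; T-≡; _≟_)
open import Data.Fin using (Fin; toℕ)
open import Data.Fin.Properties using (pigeonhole; toℕ<n; any?)
open import Data.List using ([]; _∷_; allFin; foldr; map)
open import Data.List.Membership.Propositional using (_∈_)
open import Data.List.Membership.Propositional.Properties using (∈-allFin)
open import Data.List.Relation.Unary.Any using (here; there)
import Data.List.Relation.Unary.All as All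
open import Data.List.Extrema.Nat using (argmax; f[xs]≤f[argmax])
open import Data.Product using (Σ; _×_; _,_; proj₁; proj₂; ∃-syntax)
open import Data.Sum using (inj₁; inj₂)
open import Data.Empty using (⊥; ⊥-elim)
open import Function.Bundles using (Equivalence)
open import Relation.Nullary using (¬_; yes; no)
open import Relation.Nullary.Decidable using (_×-dec_)
open import Relation.Binary using (tri<; tri≈; tri>)
open import Relation.Binary.PropositionalEquality

<ᵇ-true : ∀ {a b} → a < b → (a <ᵇ b) ≡ true
<ᵇ-true lt = Equivalence.to T-≡ (<⇒<ᵇ lt)

<ᵇ-true⁻ : ∀ {a b} → (a <ᵇ b) ≡ true → a < b
<ᵇ-true⁻ {a} {b} e = <ᵇ⇒< a b (Equivalence.from T-≡ e)

<ᵇ-false : ∀ {a b} → ¬ a < b → (a <ᵇ b) ≡ false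
<ᵇ-false ¬lt = ¬-not (λ e → ¬lt (<ᵇ-true⁻ e))

<ᵇ-flip : ∀ {a b} → a ≢ b → (b <ᵇ a) ≡ not (a <ᵇ b)
<ᵇ-flip {a} {b} a≢b with <-cmp a b
... | tri< a<b _ _ rewrite <ᵇ-true a<b = <ᵇ-false (<⇒≯ a<b)
... | tri≈ _ a≡b _ = ⊥-elim (a≢b a≡b)
... | tri> _ _ b<a rewrite <ᵇ-true b<a | <ᵇ-false (<⇒≯ b<a) = refl

and-map⁻ : ∀ {A : Set} (g : A → Bool) xs →
           foldr _∧_ true (map g xs) ≡ true → ∀ {w} → w ∈ xs → g w ≡ true
and-map⁻ g (x ∷ xs) e (here refl) = ∧-conicalˡ _ _ e
and-map⁻ g (x ∷ xs) e (there w∈xs) = and-map⁻ g xs (∧-conicalʳ _ _ e) w∈xs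

and-map⁺ : ∀ {A : Set} (g : A → Bool) xs →
           (∀ w → g w ≡ true) → foldr _∧_ true (map g xs) ≡ true
and-map⁺ g [] h = refl
and-map⁺ g (x ∷ xs) h rewrite h x = and-map⁺ g xs h

module Layers {n : ℕ} (O : Fin n → Fin n → Bool) where

  R : ℕ → Fin n → Bool
  R = remaining O

  sink⇒noArc : ∀ S v → isSinkIn O S v ≡ true →
               S v ≡ true × (∀ w → S w ≡ true → O v w ≡ false)
  sink⇒noArc S v e = ∧-conicalˡ _ _ e , noArc
    where
      noArc : ∀ w → S w ≡ true → O v w ≡ false
      noArc w Sw = subst (λ x → x ∧ O v w ≡ false) Sw
        (not-injective (and-map⁻ (λ w → not (S w ∧ O v w)) (allFin n) (∧-conicalʳ _ _ e) (∈-allFin w)))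

  noArc⇒sink : ∀ S v → S v ≡ true → (∀ w → S w ≡ true → O v w ≡ false) →
               isSinkIn O S v ≡ true
  noArc⇒sink S v Sv noArc rewrite Sv = and-map⁺ (λ w → not (S w ∧ O v w)) (allFin n) noArcInto
    where
      noArcInto : ∀ w → not (S w ∧ O v w) ≡ true
      noArcInto w with S w in Sw
      ... | false = refl
      ... | true rewrite noArc w Sw = refl

  nonSink⇒arc : ∀ S v → S v ≡ true → isSinkIn O S v ≡ false →
                ∃[ w ] (S w ≡ true × O v w ≡ true)
  nonSink⇒arc S v Sv nonSink with any? (λ w → (S w ≟ true) ×-dec (O v w ≟ true))
  ... | yes outNeighbour = outNeighbour
  ... | no ¬arc = ⊥-elim (not-¬ (noArc⇒sink S v Sv noArc) nonSink)
    where
      noArc : ∀ w → S w ≡ true → O v w ≡ false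
      noArc w Sw = ¬-not (λ Ovw → ¬arc (w , Sw , Ovw))

  survivor-remained : ∀ k v → R (suc k) v ≡ true → R k v ≡ true
  survivor-remained k v e = ∧-conicalˡ _ _ e

  survivor-nonSink : ∀ k v → R (suc k) v ≡ true → isSinkIn O (R k) v ≡ false
  survivor-nonSink k v e = not-injective (∧-conicalʳ _ _ e)

  survive : ∀ k v → R k v ≡ true → isSinkIn O (R k) v ≡ false → R (suc k) v ≡ true
  survive k v Rk nonSink rewrite Rk | nonSink = refl

  sink-removed : ∀ k v → isSinkIn O (R k) v ≡ true → R (suc k) v ≡ false
  sink-removed k v sink rewrite sink = ∧-zeroʳ _

  removed⇒sink : ∀ k v → R k v ≡ true → R (suc k) v ≡ false → isSinkIn O (R k) v ≡ true
  removed⇒sink k v Rk removed =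
    ¬-not {y = false} (λ nonSink → not-¬ (survive k v Rk nonSink) removed)

  remaining-antitone : ∀ {k j} v → k ≤ j → R j v ≡ true → R k v ≡ true
  remaining-antitone v k≤j = go (≤⇒≤′ k≤j)
    where
      go : ∀ {k j} → k ≤′ j → R j v ≡ true → R k v ≡ true
      go ≤′-refl Rj = Rj
      go (≤′-step {j} k≤j) Rj = go k≤j (survivor-remained j v Rj)

  LeavesAt : Fin n → ℕ → Set
  LeavesAt v j = R j v ≡ true × R (suc j) v ≡ false

  leavesAt-unique : ∀ v {i j} → LeavesAt v i → LeavesAt v j → i ≡ j
  leavesAt-unique v {i} {j} (Ri , ¬Ri+1) (Rj , ¬Rj+1) with <-cmp i j
  ... | tri< i<j _ _ = ⊥-elim (not-¬ (remaining-antitone v i<j Rj) ¬Ri+1)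
  ... | tri≈ _ i≡j _ = i≡j
  ... | tri> _ _ j<i = ⊥-elim (not-¬ (remaining-antitone v j<i Ri) ¬Rj+1)

  leavesAt⇒sink : ∀ v j → LeavesAt v j → isSinkIn O (R j) v ≡ true
  leavesAt⇒sink v j (Rj , ¬Rj+1) = removed⇒sink j v Rj ¬Rj+1

  blockFrom-leaves : ∀ k fuel v → R k v ≡ true → R (k + fuel) v ≡ false →
                     LeavesAt v (blockFrom O k fuel v)
  blockFrom-leaves k zero v Rk gone rewrite +-identityʳ k = ⊥-elim (not-¬ Rk gone)
  blockFrom-leaves k (suc fuel) v Rk gone with isSinkIn O (R k) v in sink
  ... | true = Rk , sink-removed k v sink
  ... | false = blockFrom-leaves (suc k) fuel v (survive k v Rk sink)
                  (subst (λ m → R m v ≡ false) (+-suc k fuel) gone)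

  Chain : ℕ → Fin n → Set
  Chain k v = Σ (ℕ → Fin n) λ x → x 0 ≡ v × (∀ i → i < k → O (x i) (x (suc i)) ≡ true)

  -- A vertex surviving k rounds is never a sink, so it starts a k-chain.
  survivor-chain : ∀ k v → R k v ≡ true → Chain k v
  survivor-chain zero v _ = (λ _ → v) , refl , λ i ()
  survivor-chain (suc k) v Rk+1
    with nonSink⇒arc (R k) v (survivor-remained k v Rk+1) (survivor-nonSink k v Rk+1)
  ... | w , Rw , Ovw with survivor-chain k w Rw
  ... | x , x0≡w , steps = y , refl , steps′
    where
      y : ℕ → Fin n
      y zero = v
      y (suc i) = x i
      steps′ : ∀ i → i < suc k → O (y i) (y (suc i)) ≡ true
      steps′ zero _ = subst (λ u → O v u ≡ true) (sym x0≡w) Ovw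
      steps′ (suc i) (s≤s i<k) = steps i i<k

  chain-walk : ∀ {k} (x : ℕ → Fin n) → (∀ i → i < k → O (x i) (x (suc i)) ≡ true) →
               ∀ {a c} → a < c → c ≤ k → Walk⁺ O (x a) (x c)
  chain-walk x steps {a} {suc c} (s≤s a≤c) c<k with m≤n⇒m<n∨m≡n a≤c
  ... | inj₂ refl = arc (steps a c<k)
  ... | inj₁ a<c = snoc (chain-walk x steps a<c (<⇒≤ c<k)) (steps c c<k)
    where
      snoc : ∀ {u v w} → Walk⁺ O u v → O v w ≡ true → Walk⁺ O u w
      snoc (arc e) e′ = e ∷ arc e′
      snoc (e ∷ p) e′ = e ∷ snoc p e′

  -- In an acyclic relation nothing survives n rounds: an n-chain visits
  -- n+1 vertices, so by pigeonhole it closes a directed cycle.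
  acyclic⇒exhausted : Acyclic O → ∀ v → R n v ≡ false
  acyclic⇒exhausted acyc v = ¬-not λ Rn → noLongChain (survivor-chain n v Rn)
    where
      noLongChain : Chain n v → ⊥
      noLongChain (x , _ , steps) with pigeonhole (n<1+n n) (λ i → x (toℕ i))
      ... | i , j , i<j , xi≡xj =
        acyc (x (toℕ i)) (subst (Walk⁺ O (x (toℕ i))) (sym xi≡xj)
          (chain-walk x steps i<j (≤-pred (toℕ<n j))))

-- A block-index function in which the predecessor of every nonzero index
-- is attained is an ordered set partition (into 1 + max blocks).
predecessor-closed⇒partition : ∀ {n} (b : Fin n → ℕ) →
  (∀ v → b v ≢ 0 → ∃[ u ] suc (b u) ≡ b v) → IsOrderedSetPartition b
predecessor-closed⇒partition {zero} b _ = 0 , (λ ()) , (λ i ())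
predecessor-closed⇒partition {suc m} b closed =
  suc (b top) , (λ v → s≤s (below-top v)) , λ i i<r → attained (b top) top refl i (≤-pred i<r)
  where
    top : Fin (suc m)
    top = argmax b Fin.zero (allFin (suc m))

    below-top : ∀ v → b v ≤ b top
    below-top v = All.lookup (f[xs]≤f[argmax] {f = b} Fin.zero (allFin (suc m))) (∈-allFin v)

    attained : ∀ k v → b v ≡ k → ∀ i → i ≤ k → ∃[ u ] b u ≡ i
    attained zero v bv≡0 .zero z≤n = v , bv≡0
    attained (suc k) v bv≡k+1 i i≤k+1 with m≤n⇒m<n∨m≡n i≤k+1
    ... | inj₂ refl = v , bv≡k+1
    ... | inj₁ i<k+1 with closed v (λ bv≡0 → 0≢1+n (trans (sym bv≡0) bv≡k+1))
    ... | u , bu+1≡bv = attained k u (suc-injective (trans bu+1≡bv bv≡k+1)) i (≤-pred i<k+1)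

module SinkBlocks {n : ℕ} (O : Fin n → Fin n → Bool) (acyc : Acyclic O) where
  open Layers O

  block : Fin n → ℕ
  block = blockFrom O 0 n

  -- Since R_n is empty, the search of blockFrom succeeds for every vertex.
  block-leaves : ∀ v → LeavesAt v (block v)
  block-leaves v = blockFrom-leaves 0 n v refl (acyclic⇒exhausted acyc v)

  block-unique : ∀ v {j} → LeavesAt v j → block v ≡ j
  block-unique v = leavesAt-unique v (block-leaves v)

  remaining⇒≤block : ∀ j v → R j v ≡ true → j ≤ block v
  remaining⇒≤block j v Rj =
    ≮⇒≥ λ bv<j → not-¬ (remaining-antitone v bv<j Rj) (proj₂ (block-leaves v))

  ≤block⇒remaining : ∀ j v → j ≤ block v → R j v ≡ true
  ≤block⇒remaining j v j≤bv = remaining-antitone v j≤bv (proj₁ (block-leaves v))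

  -- When u leaves it is a sink, so its out-neighbours have already left.
  arc-decreases : ∀ u v → O u v ≡ true → block v < block u
  arc-decreases u v Ouv = ≰⇒> λ bu≤bv → not-¬ Ouv
    (proj₂ (sink⇒noArc (R (block u)) u (leavesAt⇒sink u (block u) (block-leaves u)))
      v (≤block⇒remaining (block u) v bu≤bv))

  -- A vertex of block j+1 was no sink of R_j, so it has an arc into block j.
  arc-to-previous : ∀ v j → block v ≡ suc j → ∃[ w ] (O v w ≡ true × block w ≡ j)
  arc-to-previous v j bv≡j+1
    with Rj+1 ← ≤block⇒remaining (suc j) v (≤-reflexive (sym bv≡j+1))
    with nonSink⇒arc (R j) v (survivor-remained j v Rj+1) (survivor-nonSink j v Rj+1)
  ... | w , Rw , Ovw =
    w , Ovw , ≤-antisym (≤-pred (subst (block w <_) bv≡j+1 (arc-decreases v w Ovw)))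
                        (remaining⇒≤block j w Rw)

module SinkSequenceOf {n : ℕ} {G : Graph n} (A : AcyclicOrientation G) where
  open IsOrientation (orientation A)
  open SinkBlocks (arcs A) (acyclic A)

  arcs-by-block : ∀ u v → arcs A u v ≡ (adj G u v ∧ (block v <ᵇ block u))
  arcs-by-block u v with arcs A u v in Ouv | adj G u v in Euv
  ... | true  | true  = sym (<ᵇ-true (arc-decreases u v Ouv))
  ... | true  | false = ⊥-elim (not-¬ (arc⇒edge u v Ouv) Euv)
  ... | false | false = refl
  ... | false | true  = sym (<ᵇ-false (<⇒≯ (arc-decreases v u Ovu)))
    where
      Ovu : arcs A v u ≡ true
      Ovu = not-injective (trans (sym (edge⇒one u v Euv)) Ouv)

  stable : ∀ u v → adj G u v ≡ true → block u ≢ block v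
  stable u v Euv bu≡bv with arcs A v u in Ovu
  ... | true  = <-irrefl bu≡bv (arc-decreases v u Ovu)
  ... | false = <-irrefl (sym bu≡bv) (arc-decreases u v (trans (edge⇒one u v Euv) (cong not Ovu)))

  linked : ∀ v → block v ≢ 0 → ∃[ u ] (adj G u v ≡ true × suc (block u) ≡ block v)
  linked v bv≢0 with block v in bv
  ... | zero  = ⊥-elim (bv≢0 refl)
  ... | suc j with arc-to-previous v j bv
  ... | w , Ovw , bw≡j = w , trans (adj-sym G w v) (arc⇒edge v w Ovw) , cong suc bw≡j

  isStableLinkSequence : IsStableLinkSequence G block
  isStableLinkSequence =
    predecessor-closed⇒partition block (λ v bv≢0 → let (u , _ , e) = linked v bv≢0 in u , e)
    , stable , linked

module TowardsSmallerBlocks {n : ℕ} (G : Graph n) (b : Fin n → ℕ)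
                            (sls : IsStableLinkSequence G b) where

  O : Fin n → Fin n → Bool
  O u v = adj G u v ∧ (b v <ᵇ b u)

  arc-intro : ∀ {u v} → adj G u v ≡ true → b v < b u → O u v ≡ true
  arc-intro Euv bv<bu = cong₂ _∧_ Euv (<ᵇ-true bv<bu)

  arc-decreases : ∀ {u v} → O u v ≡ true → b v < b u
  arc-decreases Ouv = <ᵇ-true⁻ (∧-conicalʳ _ _ Ouv)

  -- Stability makes the two ends of an edge lie in different blocks.
  isOrientation : IsOrientation G O
  isOrientation = record { arc⇒edge = λ u v Ouv → ∧-conicalˡ _ _ Ouv ; edge⇒one = oneWay }
    where
      oneWay : ∀ u v → adj G u v ≡ true → O u v ≡ not (O v u)
      oneWay u v Euv rewrite Euv | trans (sym (adj-sym G u v)) Euv =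
        <ᵇ-flip (proj₁ (proj₂ sls) u v Euv)

  walk-decreases : ∀ {u w} → Walk⁺ O u w → b w < b u
  walk-decreases (arc Ouw) = arc-decreases Ouw
  walk-decreases (Ouv ∷ p) = <-trans (walk-decreases p) (arc-decreases Ouv)

  acyclicOrientation : AcyclicOrientation G
  acyclicOrientation = record
    { arcs = O ; orientation = isOrientation ; acyclic = λ v p → <-irrefl refl (walk-decreases p) }

  open Layers O

  remaining⇒≤ : ∀ k v → R k v ≡ true → k ≤ b v
  remaining⇒≤ zero v _ = z≤n
  remaining⇒≤ (suc k) v Rk+1 = ≤∧≢⇒< (remaining⇒≤ k v Rk) k≢bv
    where
      Rk : R k v ≡ true
      Rk = survivor-remained k v Rk+1
      -- if b v = k, every arc from v leads below k, hence out of R_k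
      k≢bv : k ≢ b v
      k≢bv k≡bv = not-¬ (noArc⇒sink (R k) v Rk noArc) (survivor-nonSink k v Rk+1)
        where
          noArc : ∀ w → R k w ≡ true → O v w ≡ false
          noArc w Rw = ¬-not λ Ovw →
            <⇒≱ (arc-decreases Ovw) (subst (_≤ b w) k≡bv (remaining⇒≤ k w Rw))

  ≤⇒remaining : ∀ k v → k ≤ b v → R k v ≡ true
  ≤⇒remaining zero v _ = refl
  ≤⇒remaining (suc k) v k<bv = survive k v (≤⇒remaining k v (<⇒≤ k<bv)) (¬-not notSink)
    where
      -- the link u of v lies in block b v - 1 ≥ k, so v has an arc into R_k
      notSink : isSinkIn O (R k) v ≢ true
      notSink sink with proj₂ (proj₂ sls) v (m<n⇒n≢0 k<bv)
      ... | u , Euv , bu+1≡bv =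
        not-¬ (arc-intro (trans (adj-sym G v u) Euv) (≤-reflexive bu+1≡bv))
          (proj₂ (sink⇒noArc (R k) v sink) u
            (≤⇒remaining k u (≤-pred (subst (suc k ≤_) (sym bu+1≡bv) k<bv))))

  sinkSeq≡b : ∀ v → sinkSeq acyclicOrientation v ≡ b v
  sinkSeq≡b v = SinkBlocks.block-unique O (acyclic acyclicOrientation) v
    (≤⇒remaining (b v) v ≤-refl , ¬-not λ Rbv+1 → 1+n≰n (remaining⇒≤ (suc (b v)) v Rbv+1))

theorem4p3 : ∀ (n : ℕ) (G : Graph n) →
    (∀ (A : AcyclicOrientation G) → IsStableLinkSequence G (sinkSeq A)) ×
    (∀ (A B : AcyclicOrientation G) →
      (∀ v → sinkSeq A v ≡ sinkSeq B v) →
      ∀ u v → arcs A u v ≡ arcs B u v) ×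
    (∀ (b : Fin n → ℕ) → IsStableLinkSequence G b →
      Σ (AcyclicOrientation G) λ A → (∀ v → sinkSeq A v ≡ b v))
theorem4p3 n G = SinkSequenceOf.isStableLinkSequence , injective , surjective
  where
    injective : ∀ (A B : AcyclicOrientation G) → (∀ v → sinkSeq A v ≡ sinkSeq B v) →
                ∀ u v → arcs A u v ≡ arcs B u v
    injective A B same u v = begin
      arcs A u v                                  ≡⟨ SinkSequenceOf.arcs-by-block A u v ⟩
      adj G u v ∧ (sinkSeq A v <ᵇ sinkSeq A u)    ≡⟨ cong₂ (λ x y → adj G u v ∧ (x <ᵇ y)) (same v) (same u) ⟩
      adj G u v ∧ (sinkSeq B v <ᵇ sinkSeq B u)    ≡⟨ sym (SinkSequenceOf.arcs-by-block B u v) ⟩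
      arcs B u v                                  ∎
      where open ≡-Reasoning

    surjective : ∀ (b : Fin n → ℕ) → IsStableLinkSequence G b →
                 Σ (AcyclicOrientation G) λ A → (∀ v → sinkSeq A v ≡ b v)
    surjective b sls = acyclicOrientation , sinkSeq≡b
      where open TowardsSmallerBlocks G b sls
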